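{- Let $\mathcal{A}$ be a subset of $4\mathbb{Z}^+$ containing $4$ and $8$. Let $S$ be the set of rational numbers which have a continued fraction expansion of the form $[0;a_1,a_2,\ldots,a_n,1,1,2]$ with $n\geq 0$ and all $a_i\in\mathcal{A}$. Then every positive odd integer is admissible as a denominator of elements of $S$ (i.e. for every $m\geq1$ and every odd positive integer $N$, some element of $S$ has denominator congruent to $N$ modulo $m$), yet no denominator of an element of $S$ is a perfect square. Equivalently, let $S'$ be the set of rational numbers $x/y$ (in lowest terms) with a continued fraction expansion $[0;a_1,\ldots,a_n]$ with all $a_i\in\mathcal{A}$, and let $L(x/y)=3x+5y$. Then every positive odd integer is admissible for $L(S')$ in the same sense, yet $L(S')$ contains no perfect square.
   Context: Continued fractions: $[a_0;a_1,\ldots,a_n]=a_0+\cfrac{1}{a_1+\cfrac{1}{\ddots+\cfrac{1}{a_n}}}$. Denominators refer to rationals written in lowest terms with positive denominator. -}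

module Defs where

open import Data.Nat using (ℕ; zero; suc; _+_; _*_; _<_; NonZero; _%_)
open import Data.Integer using (+_)
open import Data.Nat.Divisibility using (_∣_)
import Data.Integer as ℤ
open import Data.Rational using (ℚ; _/_; ↥_; ↧ₙ_; 0ℚ)
open import Data.List using (List; []; _∷_; _++_)
open import Data.List.Relation.Unary.All using (All)
open import Data.Product using (_×_; _,_; Σ; ∃; ∃-syntax)
open import Relation.Binary.PropositionalEquality using (_≡_)
open import Relation.Nullary using (¬_)

-- Continuants: for a₁,…,aₖ (k ≥ 1), cont (a₁ ∷ … ∷ aₖ) = (p , q) with
-- [a₁; a₂, …, aₖ] = p / q.  cont [] = (1 , 0) (the value "∞"), so that
-- cont [a] = (a , 1).
cont : List ℕ → ℕ × ℕ
cont [] = 1 , 0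
cont (a ∷ as) with cont as
... | p , q = a * p + q , p

-- q / p as a rational in lowest terms; the junk value 0 is used only when
-- p = 0, which never happens for partial quotients ≥ 1.
frac : ℕ → ℕ → ℚ
frac q zero = 0ℚ
frac q (suc p) = (+ q) / suc p

-- The value of [0; a₁, …, aₙ] as a rational number.
-- For n = 0 this is 0 = 0/1.
cf0 : List ℕ → ℚ
cf0 as with cont as
... | p , q = frac q p

record Admissible𝒜 (𝒜 : ℕ → Set) : Set where
  field
    pos     : ∀ a → 𝒜 a → 0 < a
    div4    : ∀ a → 𝒜 a → 4 ∣ a
    has4    : 𝒜 4
    has8    : 𝒜 8

InS : (ℕ → Set) → ℚ → Set
InS 𝒜 r = ∃[ as ] (All 𝒜 as × r ≡ cf0 (as ++ (1 ∷ 1 ∷ 2 ∷ [])))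

InS' : (ℕ → Set) → ℚ → Set
InS' 𝒜 r = ∃[ as ] (All 𝒜 as × r ≡ cf0 as)

den : ℚ → ℕ
den r = ↧ₙ r

-- L(x/y) = 3x + 5y with x/y in lowest terms (x ≥ 0 for elements of S')
L : ℚ → ℕ
L r = 3 * ℤ.∣ ↥ r ∣ + 5 * ↧ₙ r

IsSquare : ℕ → Set
IsSquare n = ∃[ k ] (n ≡ k * k)

AllOddAdmissible : (ℚ → Set) → (ℚ → ℕ) → Set
AllOddAdmissible P f =
  ∀ (m : ℕ) .{{_ : NonZero m}} (N : ℕ) → N % 2 ≡ 1 →
    ∃[ r ] (P r × f r % m ≡ N % m)

NoSquare : (ℚ → Set) → (ℚ → ℕ) → Set
NoSquare P f = ∀ r → P r → ¬ IsSquare (f r)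

-- Write (p, q) = cont (a₁ ∷ … ∷ aₙ), so that [0; a₁, …, aₙ] = q/p in lowest terms and
-- L = 3q + 5p.  Continuants are products of the matrices M(a) = [[a, 1], [1, 0]]; as M(1)M(1)M(2)
-- maps (1, 0) to (5, 3), the denominator of [0; a₁, …, aₙ, 1, 1, 2] is the first entry of
-- M(a₁)⋯M(aₙ)(5, 3), which by transposition is L([0; aₙ, …, a₁]).  So both statements are
-- about the numbers 3q + 5p.
--
-- If every aᵢ is divisible by 4, then one of p, q is ≡ 1 and the other ≡ 0 (mod 4), and the even
-- one has Jacobi symbol +1 modulo the odd one: a new first partial quotient reduces the new symbol
-- to the old one, by periodicity in the numerator or by periodicity in the denominator (the latter
-- a consequence of quadratic reciprocity).  When q ≡ 1 (mod 4), 3q + 5p ≡ 3 (mod 4) is not a square;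
-- when p ≡ 1 (mod 4), reciprocity gives (3q + 5p / 2q + 3p) = -1, so again 3q + 5p is no square.
-- The Jacobi symbol is developed from Schering's form of Gauss's lemma, and reciprocity from
-- Eisenstein's lattice-point count.
--
-- Conversely, modulo m the matrix M(4) has finite order d + 1, so the words 8·4ᵈ and 4ᵈ·8 act as
-- the shears (x, y) ↦ (x + 4y, y) and (x, y) ↦ (x, y + 4x).  Applying the second k times and then
-- the first j times gives the first coordinate x + 4j(y + 4kx); once k makes y + 4kx prime to m,
-- this runs through all of x + 4ℤ modulo m.  Start from (5, 3) or from M(4)(5, 3) = (23, 5),
-- according to the class of the odd target modulo 4.
module Submission where

open import Defs
open import Algebra.Bundles using (CommutativeMonoid)
open import Data.Bool.Base using (true; false)
open import Data.Fin using (Fin; toℕ; fromℕ<; punchOut; combine)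
import Data.Fin.Properties as Finₚ
open import Data.Fin.Permutation using (Permutation′; permutation)
open import Data.List using (List; []; _∷_; _++_; foldr; foldl; reverse; replicate; concat)
open import Data.List.Properties using (foldr-++; reverse-foldr; unfold-reverse)
import Data.List.Relation.Unary.All as All
open All using (All; []; _∷_)
import Data.List.Relation.Unary.All.Properties as Allₚ
open import Data.Nat
open import Data.Nat.Properties
open import Data.Nat.DivMod
open import Data.Nat.Divisibility
open import Data.Nat.Coprimality as Coprimality using (Coprime; coprime-divisor; 1-coprimeTo)
open import Data.Nat.Induction using (<-wellFounded)
open import Data.Nat.Primality using (Prime; prime?; euclidsLemma; prime⇒irreducible; prime⇒nonTrivial)
open import Data.Nat.Tactic.RingSolver using (solve-∀)
open import Data.Parity.Base as ℙ using (Parity; 0ℙ; 1ℙ)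
import Data.Parity.Properties as ℙₚ
open import Data.Product using (_×_; _,_; proj₁; proj₂; ∃; ∃₂; ∃-syntax)
open import Data.Rational.Base using (ℚ)
open import Data.Rational.Properties using (normalize-coprime)
open import Data.Sum using (_⊎_; inj₁; inj₂)
open import Function.Base using (_∘_; flip)
open import Function.Bundles using (_⇔_; mk⇔; Equivalence)
open import Function.Definitions using (Injective)
open import Induction.WellFounded using (Acc; acc)
open import Relation.Binary.Bundles using (Setoid)
import Relation.Binary.Construct.On as On
open import Relation.Binary.PropositionalEquality renaming (setoid to ≡-setoid)
open import Relation.Nullary using (Dec; _because_; yes; no; ¬_; contradiction)
open import Relation.Nullary.Decidable using (from-yes; from-no)

injective⇒surjective : ∀ {n} {f : Fin n → Fin n} → Injective _≡_ _≡_ f → ∀ y → ∃ λ x → f x ≡ y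
injective⇒surjective {suc n} {f} f-inj y with Finₚ.any? (λ x → f x Finₚ.≟ y)
... | yes hit = hit
... | no miss = contradiction (Finₚ.injective⇒≤ f-punchOut-inj) (n≮n n)
  where
  f-punchOut : Fin (suc n) → Fin n
  f-punchOut x = punchOut {i = y} (λ y≡fx → miss (x , sym y≡fx))
  f-punchOut-inj : Injective _≡_ _≡_ f-punchOut
  f-punchOut-inj = f-inj ∘ Finₚ.punchOut-injective {i = y} _ _

injective⇒permutation : ∀ {n} (f : Fin n → Fin n) → Injective _≡_ _≡_ f → Permutation′ n
injective⇒permutation f f-inj =
  permutation f (proj₁ ∘ surj) (proj₂ ∘ surj) (λ x → f-inj (proj₂ (surj (f x))))
  where
  surj : ∀ y → ∃ λ x → f x ≡ y
  surj = injective⇒surjective f-inj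

infix 4 _∈[1‥_]
_∈[1‥_] : ℕ → ℕ → Set
x ∈[1‥ h ] = 1 ≤ x × x ≤ h

module RangeSum {c ℓ} (M : CommutativeMonoid c ℓ) where

  open CommutativeMonoid M using (Carrier; _≈_; _∙_; setoid)
  open import Algebra.Properties.CommutativeMonoid.Sum M

  ∑ : ℕ → (ℕ → Carrier) → Carrier
  ∑ h f = ∑[ i < h ] f (suc (toℕ i))

  ∑-cong : ∀ h {f g} → (∀ x → x ∈[1‥ h ] → f x ≈ g x) → ∑ h f ≈ ∑ h g
  ∑-cong h f≈g = sum-cong-≋ λ i → f≈g _ (s≤s z≤n , Finₚ.toℕ<n i)

  ∑-distrib : ∀ h f g → ∑ h (λ x → f x ∙ g x) ≈ ∑ h f ∙ ∑ h g
  ∑-distrib h f g = ∑-distrib-+ {h} (f ∘ suc ∘ toℕ) (g ∘ suc ∘ toℕ)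

  ∑-swap : ∀ h k (f : ℕ → ℕ → Carrier) → ∑ h (λ x → ∑ k (f x)) ≈ ∑ k (λ y → ∑ h (λ x → f x y))
  ∑-swap h k f = ∑-comm {h} {k} (λ i j → f (suc (toℕ i)) (suc (toℕ j)))

  ∑-reindex : ∀ h (σ : ℕ → ℕ) (g : ℕ → Carrier) →
              (∀ x → x ∈[1‥ h ] → σ x ∈[1‥ h ]) →
              (∀ x y → x ∈[1‥ h ] → y ∈[1‥ h ] → σ x ≡ σ y → x ≡ y) →
              ∑ h (g ∘ σ) ≈ ∑ h g
  ∑-reindex h σ g σ∈ σ-inj = begin
    ∑ h (g ∘ σ)                        ≡⟨ sum-cong-≗ (cong g ∘ sym ∘ σ̂-toℕ) ⟩
    ∑[ i < h ] g (suc (toℕ (σ̂ i)))    ≈⟨ sum-permute _ (injective⇒permutation σ̂ σ̂-inj) ⟨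
    ∑ h g                              ∎
    where
    open import Relation.Binary.Reasoning.Setoid setoid
    in-range : ∀ i → suc (toℕ i) ∈[1‥ h ]
    in-range i = s≤s z≤n , Finₚ.toℕ<n i
    σ<h : ∀ (i : Fin h) → pred (σ (suc (toℕ i))) < h
    σ<h i with σ (suc (toℕ i)) | σ∈ _ (in-range i)
    ... | suc y | _ , y<h = y<h
    σ̂ : Fin h → Fin h
    σ̂ i = fromℕ< (σ<h i)
    σ̂-toℕ : ∀ i → suc (toℕ (σ̂ i)) ≡ σ (suc (toℕ i))
    σ̂-toℕ i with σ (suc (toℕ i)) | σ∈ _ (in-range i) | σ<h i
    ... | suc y | _ | y<h = cong suc (Finₚ.toℕ-fromℕ< y<h)
    σ̂-inj : Injective _≡_ _≡_ σ̂
    σ̂-inj {i} {j} eq = Finₚ.toℕ-injective (suc-injective (σ-inj _ _ (in-range i) (in-range j)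
      (trans (sym (σ̂-toℕ i)) (trans (cong (suc ∘ toℕ) eq) (σ̂-toℕ j)))))

module ℕ∑ = RangeSum +-0-commutativeMonoid
module ℙ∑ = RangeSum ℙₚ.+-0-commutativeMonoid

∑-const : ∀ h c → ℕ∑.∑ h (λ _ → c) ≡ h * c
∑-const zero    c = refl
∑-const (suc h) c = cong (c +_) (∑-const h c)

parity-∑ : ∀ h f → parity (ℕ∑.∑ h f) ≡ ℙ∑.∑ h (parity ∘ f)
parity-∑ zero    f = refl
parity-∑ (suc h) f =
  trans (ℙₚ.+-homo-+ (f 1) (ℕ∑.∑ h (f ∘ suc))) (cong (parity (f 1) ℙ.+_) (parity-∑ h (f ∘ suc)))

𝟙 : ∀ {p} {P : Set p} → Dec P → ℕ
𝟙 (true  because _) = 1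
𝟙 (false because _) = 0

𝟙-cong : ∀ {p q} {P : Set p} {Q : Set q} → P ⇔ Q → (P? : Dec P) (Q? : Dec Q) → 𝟙 P? ≡ 𝟙 Q?
𝟙-cong P⇔Q (yes _) (yes _) = refl
𝟙-cong P⇔Q (no  _) (no  _) = refl
𝟙-cong P⇔Q (yes p) (no ¬q) = contradiction (Equivalence.to P⇔Q p) ¬q
𝟙-cong P⇔Q (no ¬p) (yes q) = contradiction (Equivalence.from P⇔Q q) ¬p

𝟙-<-+-𝟙->≡1 : ∀ u v → u ≢ v → 𝟙 (u <? v) + 𝟙 (v <? u) ≡ 1
𝟙-<-+-𝟙->≡1 u v u≢v with u <? v | v <? u
... | yes u<v | yes v<u = contradiction v<u (<-asym u<v)
... | yes _   | no  _   = refl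
... | no  _   | yes _   = refl
... | no  u≮v | no  v≮u = contradiction (≤-antisym (≮⇒≥ v≮u) (≮⇒≥ u≮v)) u≢v

count-< : ∀ c B → ℕ∑.∑ B (λ x → 𝟙 (c <? x)) ≡ B ∸ c
count-< c       zero    = sym (0∸n≡0 c)
count-< zero    (suc B) = cong suc (trans (∑-const B 1) (*-identityʳ B))
count-< (suc c) (suc B) =
  trans (ℕ∑.∑-cong B (λ x _ → 𝟙-cong (mk⇔ s≤s⁻¹ s≤s) (suc c <? suc x) (c <? x))) (count-< c B)

count-≤ : ∀ q B → q ≤ B → ℕ∑.∑ B (λ y → 𝟙 (y ≤? q)) ≡ q
count-≤ zero    zero    _   = refl
count-≤ zero    (suc B) _   = trans (∑-const B 0) (*-zeroʳ B)
count-≤ (suc q) (suc B) q<B = cong suc (trans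
  (ℕ∑.∑-cong B (λ y _ → 𝟙-cong (mk⇔ s≤s⁻¹ s≤s) (suc y ≤? suc q) (y ≤? q)))
  (count-≤ q B (s≤s⁻¹ q<B)))

%-≡⇒∣∸ : ∀ u v n .{{_ : NonZero n}} → u % n ≡ v % n → n ∣ v ∸ u
%-≡⇒∣∸ u v n eq = divides (v / n ∸ u / n) (begin
  v ∸ u                                       ≡⟨ cong₂ _∸_ (m≡m%n+[m/n]*n v n) (m≡m%n+[m/n]*n u n) ⟩
  (v % n + v / n * n) ∸ (u % n + u / n * n)   ≡⟨ cong (λ r → (r + v / n * n) ∸ (u % n + u / n * n)) eq ⟨
  (u % n + v / n * n) ∸ (u % n + u / n * n)   ≡⟨ [m+n]∸[m+o]≡n∸o (u % n) (v / n * n) (u / n * n) ⟩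
  v / n * n ∸ u / n * n                       ≡⟨ *-distribʳ-∸ n (v / n) (u / n) ⟨
  (v / n ∸ u / n) * n                         ∎)
  where open ≡-Reasoning

∣∸⇒%-≡ : ∀ {u v} n .{{_ : NonZero n}} → u ≤ v → n ∣ v ∸ u → u % n ≡ v % n
∣∸⇒%-≡ {u} {v} n u≤v (divides k v∸u≡kn) = begin
  u % n              ≡⟨ [m+kn]%n≡m%n u k n ⟨
  (u + k * n) % n    ≡⟨ cong (λ d → (u + d) % n) v∸u≡kn ⟨
  (u + (v ∸ u)) % n  ≡⟨ cong (_% n) (m+[n∸m]≡n u≤v) ⟩
  v % n              ∎
  where open ≡-Reasoning

+-cancelˡ-% : ∀ a {b c} n .{{_ : NonZero n}} → (a + b) % n ≡ (a + c) % n → b % n ≡ c % n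
+-cancelˡ-% a {b} {c} n eq with ≤-total b c
... | inj₁ b≤c = ∣∸⇒%-≡ n b≤c (subst (n ∣_) ([m+n]∸[m+o]≡n∸o a c b) (%-≡⇒∣∸ (a + b) (a + c) n eq))
... | inj₂ c≤b =
  sym (∣∸⇒%-≡ n c≤b (subst (n ∣_) ([m+n]∸[m+o]≡n∸o a b c) (%-≡⇒∣∸ (a + c) (a + b) n (sym eq))))

*-cancelˡ-% : ∀ {a} b c n .{{_ : NonZero n}} → Coprime a n → (a * b) % n ≡ (a * c) % n → b % n ≡ c % n
*-cancelˡ-% {a} b c n a⊥n eq with ≤-total b c
... | inj₁ b≤c = ∣∸⇒%-≡ n b≤c (coprime-divisor (Coprimality.sym a⊥n)
                   (subst (n ∣_) (sym (*-distribˡ-∸ a c b)) (%-≡⇒∣∸ (a * b) (a * c) n eq)))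
... | inj₂ c≤b = sym (∣∸⇒%-≡ n c≤b (coprime-divisor (Coprimality.sym a⊥n)
                   (subst (n ∣_) (sym (*-distribˡ-∸ a b c)) (%-≡⇒∣∸ (a * c) (a * b) n (sym eq)))))

∣∧<⇒≡0 : ∀ {n d} → n ∣ d → d < n → d ≡ 0
∣∧<⇒≡0 {d = zero}  _   _   = refl
∣∧<⇒≡0 {d = suc d} n∣d d<n = contradiction (∣⇒≤ n∣d) (<⇒≱ d<n)

%-complement : ∀ u v n .{{_ : NonZero n}} → (u + v) % n ≡ 0 → v % n ≢ 0 → u % n + v % n ≡ n
%-complement u v n u+v≡0 v≢0 = begin
  s                  ≡⟨ m≡m%n+[m/n]*n s n ⟩
  s % n + s / n * n  ≡⟨ cong₂ (λ r q → r + q * n) s%n≡0 s/n≡1 ⟩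
  0 + 1 * n          ≡⟨ *-identityˡ n ⟩
  n                  ∎
  where
  open ≡-Reasoning
  s : ℕ
  s = u % n + v % n
  s%n≡0 : s % n ≡ 0
  s%n≡0 = trans (sym (%-distribˡ-+ u v n)) u+v≡0
  s/n≢0 : s / n ≢ 0
  s/n≢0 s/n≡0 = v≢0 (m+n≡0⇒n≡0 (u % n) (trans (sym (m<n⇒m%n≡m (m/n≡0⇒m<n s/n≡0))) s%n≡0))
  s/n<2 : s / n < 2
  s/n<2 = m<n*o⇒m/o<n (+-mono-< (m%n<n u n) (<-≤-trans (m%n<n v n) (m≤m+n n 0)))
  s/n≡1 : s / n ≡ 1
  s/n≡1 = ≤-antisym (s≤s⁻¹ s/n<2) (n≢0⇒n>0 s/n≢0)

m*[n%o]%o≡m*n%o : ∀ m n o .{{_ : NonZero o}} → m * (n % o) % o ≡ m * n % o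
m*[n%o]%o≡m*n%o m n o = begin
  m * (n % o) % o          ≡⟨ %-distribˡ-* m (n % o) o ⟩
  m % o * (n % o % o) % o  ≡⟨ cong (λ r → m % o * r % o) (m%n%n≡m%n n o) ⟩
  m % o * (n % o) % o      ≡⟨ %-distribˡ-* m n o ⟨
  m * n % o                ∎
  where open ≡-Reasoning

m*n*o%p≡m*[n*o%p]%p : ∀ m n o p .{{_ : NonZero p}} → m * n * o % p ≡ m * (n * o % p) % p
m*n*o%p≡m*[n*o%p]%p m n o p = trans (cong (_% p) (*-assoc m n o)) (sym (m*[n%o]%o≡m*n%o m (n * o) p))

coprime-*ˡ : ∀ {a b n} → Coprime (a * b) n → Coprime a n
coprime-*ˡ {b = b} ab⊥n (d∣a , d∣n) = ab⊥n (∣m⇒∣m*n b d∣a , d∣n)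

coprime-*ʳ : ∀ {a b n} → Coprime (a * b) n → Coprime b n
coprime-*ʳ {a} ab⊥n (d∣b , d∣n) = ab⊥n (∣n⇒∣m*n a d∣b , d∣n)

coprime-* : ∀ {a b n} → Coprime a n → Coprime b n → Coprime (a * b) n
coprime-* {a} {b} a⊥n b⊥n {d} (d∣ab , d∣n) = b⊥n (coprime-divisor d⊥a d∣ab , d∣n)
  where
  d⊥a : Coprime d a
  d⊥a (e∣d , e∣a) = a⊥n (e∣a , ∣-trans e∣d d∣n)

coprime-+* : ∀ {a n} k → Coprime a n → Coprime a (n + k * a)
coprime-+* {a} {n} k a⊥n {d} (d∣a , d∣n+ka) =
  a⊥n (d∣a , ∣m+n∣m⇒∣n (subst (d ∣_) (+-comm n (k * a)) d∣n+ka) (∣n⇒∣m*n k d∣a))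

-- The Jacobi symbol

odd : ℕ → ℕ
odd h = suc (h + h)

h<odd : ∀ h → h < odd h
h<odd h = s≤s (m≤m+n h h)

double⊎odd : ∀ n → ∃[ c ] (n ≡ c + c ⊎ n ≡ odd c)
double⊎odd zero = 0 , inj₁ refl
double⊎odd (suc n) with double⊎odd n
... | c , inj₁ refl = c , inj₂ refl
... | c , inj₂ refl = suc c , inj₁ (cong suc (sym (+-suc c c)))

2-coprime-odd : ∀ h → Coprime 2 (odd h)
2-coprime-odd h = subst (Coprime 2) (1+h*2≡odd h) (coprime-+* h (Coprimality.sym (1-coprimeTo 2)))
  where
  1+h*2≡odd : ∀ h → 1 + h * 2 ≡ suc (h + h)
  1+h*2≡odd = solve-∀

parity-double : ∀ m → parity (m + m) ≡ 0ℙ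
parity-double m = trans (ℙₚ.+-homo-+ m m) (ℙₚ.p+p≡0ℙ (parity m))

parity-odd : ∀ h → parity (odd h) ≡ 1ℙ
parity-odd h = trans (ℙₚ.+-homo-+ 1 (h + h)) (cong (1ℙ ℙ.+_) (parity-double h))

p+q≡0ℙ⇒p≡q : ∀ {p q} → p ℙ.+ q ≡ 0ℙ → p ≡ q
p+q≡0ℙ⇒p≡q {0ℙ} {0ℙ} _ = refl
p+q≡0ℙ⇒p≡q {1ℙ} {1ℙ} _ = refl

p+q≡1ℙ⇒q≡p⁻¹ : ∀ {p q} → p ℙ.+ q ≡ 1ℙ → q ≡ p ℙ.⁻¹
p+q≡1ℙ⇒q≡p⁻¹ {0ℙ} {1ℙ} _ = refl
p+q≡1ℙ⇒q≡p⁻¹ {1ℙ} {0ℙ} _ = refl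

upper : ℕ → ℕ → ℕ → Parity
upper a h x = parity (𝟙 (h <? a * x % odd h))

-- Schering's form of Gauss's lemma, taken as the definition: for a coprime to n = 2h+1 the
-- Jacobi symbol (a/n) is (-1)^k with k = #{x ∈ [1,h] : a·x mod n > h}.  It is written
-- additively: 0ℙ stands for +1 and 1ℙ for -1.
jacobi : ℕ → ℕ → Parity
jacobi a h = ℙ∑.∑ h (upper a h)

-- the absolute value of the representative of a·x mod n = 2h+1 in (-n/2, n/2)
absRes : ℕ → ℕ → ℕ → ℕ
absRes a h x with h <? a * x % odd h
... | yes _ = odd h ∸ a * x % odd h
... | no  _ = a * x % odd h

upper-complement : ∀ h s t → s + t ≡ odd h → parity (𝟙 (h <? s)) ≡ parity (𝟙 (h <? t)) ℙ.⁻¹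
upper-complement h s t s+t≡n with h <? s | h <? t
... | yes h<s | yes h<t =
  contradiction s+t≡n (>⇒≢ (<-≤-trans (s≤s (+-monoʳ-< h (n<1+n h))) (+-mono-≤ h<s h<t)))
... | yes _   | no  _   = refl
... | no  _   | yes _   = refl
... | no  h≮s | no  h≮t = contradiction s+t≡n (<⇒≢ (s≤s (+-mono-≤ (≮⇒≥ h≮s) (≮⇒≥ h≮t))))

module _ {h : ℕ} where

  private
    n : ℕ
    n = odd h

  residue-parity : ∀ a x → parity (a * x % n) ≡ upper a h x ℙ.+ parity (absRes a h x)
  residue-parity a x with h <? a * x % n
  ... | no  _ = refl
  ... | yes _ = p+q≡1ℙ⇒q≡p⁻¹ (begin
    parity (n ∸ r) ℙ.+ parity r  ≡⟨ ℙₚ.+-homo-+ (n ∸ r) r ⟨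
    parity (n ∸ r + r)           ≡⟨ cong parity (m∸n+n≡m (<⇒≤ (m%n<n (a * x) n))) ⟩
    parity n                     ≡⟨ parity-odd h ⟩
    1ℙ                           ∎)
    where
    open ≡-Reasoning
    r : ℕ
    r = a * x % n

  module _ {a : ℕ} (a⊥n : Coprime a (odd h)) where

    residue≢0 : ∀ {x} → x ∈[1‥ h ] → a * x % n ≢ 0
    residue≢0 {x} (1≤x , x≤h) r≡0 = m<n⇒n≢0 1≤x (∣∧<⇒≡0 n∣x (≤-<-trans x≤h (h<odd h)))
      where
      n∣x : n ∣ x
      n∣x = coprime-divisor (Coprimality.sym a⊥n) (m%n≡0⇒n∣m (a * x) n r≡0)

    absRes-∈ : ∀ {x} → x ∈[1‥ h ] → absRes a h x ∈[1‥ h ]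
    absRes-∈ {x} x∈ with h <? a * x % n
    ... | yes h<r = m<n⇒0<n∸m (m%n<n (a * x) n) , ≤-trans (∸-monoʳ-≤ n h<r) (≤-reflexive (m+n∸n≡m h h))
    ... | no  h≮r = n≢0⇒n>0 (residue≢0 x∈) , ≮⇒≥ h≮r

    residue-injective : ∀ {x y} → x ∈[1‥ h ] → y ∈[1‥ h ] → a * x % n ≡ a * y % n → x ≡ y
    residue-injective {x} {y} (_ , x≤h) (_ , y≤h) eq = begin
      x      ≡⟨ m<n⇒m%n≡m (≤-<-trans x≤h (h<odd h)) ⟨
      x % n  ≡⟨ *-cancelˡ-% x y n a⊥n eq ⟩
      y % n  ≡⟨ m<n⇒m%n≡m (≤-<-trans y≤h (h<odd h)) ⟩
      y      ∎
      where open ≡-Reasoning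

    residue-+≢odd : ∀ {x y} → x ∈[1‥ h ] → y ∈[1‥ h ] → a * x % n + a * y % n ≢ n
    residue-+≢odd {x} {y} (1≤x , x≤h) (_ , y≤h) eq =
      m<n⇒n≢0 (≤-trans 1≤x (m≤m+n x y)) (∣∧<⇒≡0 n∣x+y (s≤s (+-mono-≤ x≤h y≤h)))
      where
      open ≡-Reasoning
      n∣x+y : n ∣ x + y
      n∣x+y = coprime-divisor (Coprimality.sym a⊥n) (m%n≡0⇒n∣m (a * (x + y)) n (begin
        a * (x + y) % n              ≡⟨ cong (_% n) (*-distribˡ-+ a x y) ⟩
        (a * x + a * y) % n          ≡⟨ %-distribˡ-+ (a * x) (a * y) n ⟩
        (a * x % n + a * y % n) % n  ≡⟨ cong (_% n) eq ⟩
        n % n                        ≡⟨ n%n≡0 n ⟩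
        0                            ∎))

    absRes-injective : ∀ {x y} → x ∈[1‥ h ] → y ∈[1‥ h ] → absRes a h x ≡ absRes a h y → x ≡ y
    absRes-injective {x} {y} x∈ y∈ eq with h <? a * x % n | h <? a * y % n
    ... | yes _ | yes _ =
      residue-injective x∈ y∈ (∸-cancelˡ-≡ (<⇒≤ (m%n<n (a * x) n)) (<⇒≤ (m%n<n (a * y) n)) eq)
    ... | no  _ | no  _ = residue-injective x∈ y∈ eq
    ... | yes _ | no  _ = contradiction
      (trans (cong (a * x % n +_) (sym eq)) (m+[n∸m]≡n (<⇒≤ (m%n<n (a * x) n)))) (residue-+≢odd x∈ y∈)
    ... | no  _ | yes _ = contradiction
      (trans (cong (a * y % n +_) eq) (m+[n∸m]≡n (<⇒≤ (m%n<n (a * y) n)))) (residue-+≢odd y∈ x∈)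

  upper-* : ∀ {a b} → Coprime a (odd h) → Coprime b (odd h) → ∀ {x} → x ∈[1‥ h ] →
            upper (a * b) h x ≡ upper b h x ℙ.+ upper a h (absRes b h x)
  upper-* {a} {b} a⊥n b⊥n {x} x∈ with h <? b * x % n | absRes-∈ b⊥n x∈
  ... | no  _ | _  = cong (λ s → parity (𝟙 (h <? s))) (m*n*o%p≡m*[n*o%p]%p a b x n)
  ... | yes _ | f∈ = trans (cong (λ s → parity (𝟙 (h <? s))) (m*n*o%p≡m*[n*o%p]%p a b x n))
    (upper-complement h (a * r % n) (a * f % n) (%-complement (a * r) (a * f) n ar+af≡0 (residue≢0 a⊥n f∈)))
    where
    open ≡-Reasoning
    r f : ℕ
    r = b * x % n
    f = n ∸ r
    ar+af≡0 : (a * r + a * f) % n ≡ 0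
    ar+af≡0 = begin
      (a * r + a * f) % n  ≡⟨ cong (_% n) (*-distribˡ-+ a r f) ⟨
      a * (r + f) % n      ≡⟨ cong (λ m → a * m % n) (m+[n∸m]≡n (<⇒≤ (m%n<n (b * x) n))) ⟩
      a * n % n            ≡⟨ m*n%n≡0 a n ⟩
      0                    ∎

  jacobi-* : ∀ {a b} → Coprime a (odd h) → Coprime b (odd h) →
             jacobi (a * b) h ≡ jacobi a h ℙ.+ jacobi b h
  jacobi-* {a} {b} a⊥n b⊥n = begin
    jacobi (a * b) h
      ≡⟨ ℙ∑.∑-cong h (λ _ → upper-* a⊥n b⊥n) ⟩
    ℙ∑.∑ h (λ x → upper b h x ℙ.+ upper a h (absRes b h x))
      ≡⟨ ℙ∑.∑-distrib h (upper b h) (upper a h ∘ absRes b h) ⟩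
    jacobi b h ℙ.+ ℙ∑.∑ h (upper a h ∘ absRes b h)
      ≡⟨ cong (jacobi b h ℙ.+_) (ℙ∑.∑-reindex h (absRes b h) (upper a h)
           (λ _ → absRes-∈ b⊥n) (λ _ _ → absRes-injective b⊥n)) ⟩
    jacobi b h ℙ.+ jacobi a h
      ≡⟨ ℙₚ.+-comm (jacobi b h) (jacobi a h) ⟩
    jacobi a h ℙ.+ jacobi b h ∎
    where open ≡-Reasoning

  jacobi-cong : ∀ a b → a % n ≡ b % n → jacobi a h ≡ jacobi b h
  jacobi-cong a b a≡b = ℙ∑.∑-cong h λ x _ → cong (λ r → parity (𝟙 (h <? r))) (begin
    a * x % n            ≡⟨ %-distribˡ-* a x n ⟩
    a % n * (x % n) % n  ≡⟨ cong (λ r → r * (x % n) % n) a≡b ⟩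
    b % n * (x % n) % n  ≡⟨ %-distribˡ-* b x n ⟨
    b * x % n            ∎)
    where open ≡-Reasoning

  jacobi-+* : ∀ a k → jacobi (a + k * odd h) h ≡ jacobi a h
  jacobi-+* a k = jacobi-cong (a + k * odd h) a ([m+kn]%n≡m%n a k n)

  jacobi-square : ∀ {k} → Coprime k (odd h) → jacobi (k * k) h ≡ 0ℙ
  jacobi-square {k} k⊥n = trans (jacobi-* k⊥n k⊥n) (ℙₚ.p+p≡0ℙ (jacobi k h))

  -- x ≡ a·x = (a·x mod n) + ⌊a·x/n⌋·n modulo 2, as a and n are odd
  parity-split : ∀ {a} → parity a ≡ 1ℙ → ∀ x →
                 parity x ≡ upper a h x ℙ.+ parity (absRes a h x) ℙ.+ parity (a * x / n)
  parity-split {a} a-odd x = begin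
    parity x                                ≡⟨ cong (ℙ._* parity x) a-odd ⟨
    parity a ℙ.* parity x                   ≡⟨ ℙₚ.*-homo-* a x ⟨
    parity (a * x)                          ≡⟨ cong parity (m≡m%n+[m/n]*n (a * x) n) ⟩
    parity (a * x % n + q * n)              ≡⟨ ℙₚ.+-homo-+ (a * x % n) (q * n) ⟩
    parity (a * x % n) ℙ.+ parity (q * n)   ≡⟨ cong₂ ℙ._+_ (residue-parity a x) (ℙₚ.*-homo-* q n) ⟩
    R ℙ.+ (parity q ℙ.* parity n)           ≡⟨ cong (λ p → R ℙ.+ (parity q ℙ.* p)) (parity-odd h) ⟩
    R ℙ.+ (parity q ℙ.* 1ℙ)                 ≡⟨ cong (R ℙ.+_) (ℙₚ.*-identityʳ (parity q)) ⟩
    R ℙ.+ parity q                          ∎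
    where
    open ≡-Reasoning
    q : ℕ
    q = a * x / n
    R : Parity
    R = upper a h x ℙ.+ parity (absRes a h x)

  private
    p≡[q+p]+r⇒q≡r : ∀ p q r → p ≡ q ℙ.+ p ℙ.+ r → q ≡ r
    p≡[q+p]+r⇒q≡r 0ℙ 0ℙ 0ℙ _  = refl
    p≡[q+p]+r⇒q≡r 0ℙ 1ℙ 1ℙ _  = refl
    p≡[q+p]+r⇒q≡r 1ℙ 0ℙ 0ℙ _  = refl
    p≡[q+p]+r⇒q≡r 1ℙ 1ℙ 1ℙ _  = refl
    p≡[q+p]+r⇒q≡r 0ℙ 0ℙ 1ℙ ()
    p≡[q+p]+r⇒q≡r 0ℙ 1ℙ 0ℙ ()
    p≡[q+p]+r⇒q≡r 1ℙ 0ℙ 1ℙ ()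
    p≡[q+p]+r⇒q≡r 1ℙ 1ℙ 0ℙ ()

  eisenstein : ∀ {a} → parity a ≡ 1ℙ → Coprime a (odd h) →
               jacobi a h ≡ ℙ∑.∑ h (λ x → parity (a * x / n))
  eisenstein {a} a-odd a⊥n = p≡[q+p]+r⇒q≡r (ℙ∑.∑ h parity) (jacobi a h) Q (begin
    ℙ∑.∑ h parity
      ≡⟨ ℙ∑.∑-cong h (λ x _ → parity-split {a} a-odd x) ⟩
    ℙ∑.∑ h (λ x → upper a h x ℙ.+ parity (absRes a h x) ℙ.+ parity (a * x / n))
      ≡⟨ ℙ∑.∑-distrib h (λ x → upper a h x ℙ.+ parity (absRes a h x)) (λ x → parity (a * x / n)) ⟩
    ℙ∑.∑ h (λ x → upper a h x ℙ.+ parity (absRes a h x)) ℙ.+ Q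
      ≡⟨ cong (ℙ._+ Q) (ℙ∑.∑-distrib h (upper a h) (parity ∘ absRes a h)) ⟩
    jacobi a h ℙ.+ ℙ∑.∑ h (parity ∘ absRes a h) ℙ.+ Q
      ≡⟨ cong (λ s → jacobi a h ℙ.+ s ℙ.+ Q)
           (ℙ∑.∑-reindex h (absRes a h) parity (λ _ → absRes-∈ a⊥n) (λ _ _ → absRes-injective a⊥n)) ⟩
    jacobi a h ℙ.+ ℙ∑.∑ h parity ℙ.+ Q ∎)
    where
    open ≡-Reasoning
    Q = ℙ∑.∑ h (λ x → parity (a * x / n))

-- Quadratic reciprocity

module _ {hm hn : ℕ} (m⊥n : Coprime (odd hm) (odd hn)) where

  private
    m n : ℕ
    m = odd hm
    n = odd hn

  n*y≢m*x : ∀ {x} y → x ∈[1‥ hn ] → n * y ≢ m * x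
  n*y≢m*x {x} y (1≤x , x≤hn) eq = m<n⇒n≢0 1≤x (∣∧<⇒≡0 n∣x (≤-<-trans x≤hn (h<odd hn)))
    where
    n∣x : n ∣ x
    n∣x = coprime-divisor (Coprimality.sym m⊥n) (divides y (trans (sym eq) (*-comm n y)))

  ⌊m*x/n⌋≡count : ∀ {x} → x ∈[1‥ hn ] → m * x / n ≡ ℕ∑.∑ hm (λ y → 𝟙 (n * y <? m * x))
  ⌊m*x/n⌋≡count {x} x∈@(_ , x≤hn) = sym (trans
    (ℕ∑.∑-cong hm (λ y _ → 𝟙-cong (mk⇔ below⇒≤ ≤⇒below) (n * y <? m * x) (y ≤? q)))
    (count-≤ q hm q≤hm))
    where
    q : ℕ
    q = m * x / n
    below⇒≤ : ∀ {y} → n * y < m * x → y ≤ q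
    below⇒≤ {y} ny<mx =
      subst (_≤ q) (m*n/n≡m y n) (/-monoˡ-≤ n (≤-trans (≤-reflexive (*-comm y n)) (<⇒≤ ny<mx)))
    ≤⇒below : ∀ {y} → y ≤ q → n * y < m * x
    ≤⇒below {y} y≤q = ≤∧≢⇒<
      (≤-trans (*-monoʳ-≤ n y≤q) (≤-trans (≤-reflexive (*-comm n q)) (m/n*n≤m (m * x) n)))
      (n*y≢m*x y x∈)
    q≤hm : q ≤ hm
    q≤hm = s≤s⁻¹ (m<n*o⇒m/o<n (begin-strict
      m * x                   ≤⟨ *-monoʳ-≤ m x≤hn ⟩
      m * hn                  <⟨ m<m+n (m * hn) z<s ⟩
      m * hn + suc (hm + hn)  ≡⟨ identity hm hn ⟩
      suc hm * n              ∎))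
      where
      open ≤-Reasoning
      identity : ∀ a b → suc (a + a) * b + suc (a + b) ≡ suc a * suc (b + b)
      identity = solve-∀

lattice-count : ∀ {hm hn} → Coprime (odd hm) (odd hn) →
                ℕ∑.∑ hn (λ x → odd hm * x / odd hn) + ℕ∑.∑ hm (λ y → odd hn * y / odd hm) ≡ hn * hm
lattice-count {hm} {hn} m⊥n = begin
  ℕ∑.∑ hn (λ x → m * x / n) + ℕ∑.∑ hm (λ y → n * y / m)
    ≡⟨ cong₂ _+_ (ℕ∑.∑-cong hn (λ _ → ⌊m*x/n⌋≡count {hm} {hn} m⊥n))
                 (ℕ∑.∑-cong hm (λ _ → ⌊m*x/n⌋≡count {hn} {hm} (Coprimality.sym m⊥n))) ⟩
  ℕ∑.∑ hn (λ x → ℕ∑.∑ hm (below x)) + ℕ∑.∑ hm (λ y → ℕ∑.∑ hn (λ x → above x y))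
    ≡⟨ cong (ℕ∑.∑ hn (λ x → ℕ∑.∑ hm (below x)) +_) (ℕ∑.∑-swap hm hn (λ y x → above x y)) ⟩
  ℕ∑.∑ hn (λ x → ℕ∑.∑ hm (below x)) + ℕ∑.∑ hn (λ x → ℕ∑.∑ hm (above x))
    ≡⟨ ℕ∑.∑-distrib hn (λ x → ℕ∑.∑ hm (below x)) (λ x → ℕ∑.∑ hm (above x)) ⟨
  ℕ∑.∑ hn (λ x → ℕ∑.∑ hm (below x) + ℕ∑.∑ hm (above x))
    ≡⟨ ℕ∑.∑-cong hn (λ x x∈ → trans (sym (ℕ∑.∑-distrib hm (below x) (above x)))
         (ℕ∑.∑-cong hm (λ y _ → 𝟙-<-+-𝟙->≡1 (n * y) (m * x) (n*y≢m*x {hm} {hn} m⊥n y x∈)))) ⟩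
  ℕ∑.∑ hn (λ _ → ℕ∑.∑ hm (λ _ → 1))
    ≡⟨ ℕ∑.∑-cong hn (λ _ _ → trans (∑-const hm 1) (*-identityʳ hm)) ⟩
  ℕ∑.∑ hn (λ _ → hm)
    ≡⟨ ∑-const hn hm ⟩
  hn * hm ∎
  where
  open ≡-Reasoning
  m n : ℕ
  m = odd hm
  n = odd hn
  below above : ℕ → ℕ → ℕ
  below x y = 𝟙 (n * y <? m * x)
  above x y = 𝟙 (m * x <? n * y)

reciprocity : ∀ {h k} → Coprime (odd h) (odd k) →
              jacobi (odd h) k ℙ.+ jacobi (odd k) h ≡ parity k ℙ.* parity h
reciprocity {h} {k} h⊥k = begin
  jacobi (odd h) k ℙ.+ jacobi (odd k) h
    ≡⟨ cong₂ ℙ._+_ (eisenstein {k} (parity-odd h) h⊥k) (eisenstein {h} (parity-odd k) (Coprimality.sym h⊥k)) ⟩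
  ℙ∑.∑ k (parity ∘ ⌊h/k⌋) ℙ.+ ℙ∑.∑ h (parity ∘ ⌊k/h⌋)
    ≡⟨ cong₂ ℙ._+_ (parity-∑ k ⌊h/k⌋) (parity-∑ h ⌊k/h⌋) ⟨
  parity (ℕ∑.∑ k ⌊h/k⌋) ℙ.+ parity (ℕ∑.∑ h ⌊k/h⌋)
    ≡⟨ ℙₚ.+-homo-+ (ℕ∑.∑ k ⌊h/k⌋) (ℕ∑.∑ h ⌊k/h⌋) ⟨
  parity (ℕ∑.∑ k ⌊h/k⌋ + ℕ∑.∑ h ⌊k/h⌋)
    ≡⟨ cong parity (lattice-count {h} {k} h⊥k) ⟩
  parity (k * h)
    ≡⟨ ℙₚ.*-homo-* k h ⟩
  parity k ℙ.* parity h ∎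
  where
  open ≡-Reasoning
  ⌊h/k⌋ ⌊k/h⌋ : ℕ → ℕ
  ⌊h/k⌋ x = odd h * x / odd k
  ⌊k/h⌋ y = odd k * y / odd h

⌊n/2⌋+⌊n/2⌋≤n : ∀ n → ⌊ n /2⌋ + ⌊ n /2⌋ ≤ n
⌊n/2⌋+⌊n/2⌋≤n n = ≤-trans (+-monoʳ-≤ ⌊ n /2⌋ (⌊n/2⌋≤⌈n/2⌉ n)) (≤-reflexive (⌊n/2⌋+⌈n/2⌉≡n n))

n≤1+⌊n/2⌋+⌊n/2⌋ : ∀ n → n ≤ suc (⌊ n /2⌋ + ⌊ n /2⌋)
n≤1+⌊n/2⌋+⌊n/2⌋ zero          = z≤n
n≤1+⌊n/2⌋+⌊n/2⌋ (suc zero)    = s≤s z≤n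
n≤1+⌊n/2⌋+⌊n/2⌋ (suc (suc n)) =
  s≤s (s≤s (≤-trans (n≤1+⌊n/2⌋+⌊n/2⌋ n) (≤-reflexive (sym (+-suc ⌊ n /2⌋ ⌊ n /2⌋)))))

n<2*m⇔⌊n/2⌋<m : ∀ n m → n < 2 * m ⇔ ⌊ n /2⌋ < m
n<2*m⇔⌊n/2⌋<m n m = mk⇔ to from
  where
  open ≤-Reasoning
  2*m≡m+m : 2 * m ≡ m + m
  2*m≡m+m = cong (m +_) (+-identityʳ m)
  to : n < 2 * m → ⌊ n /2⌋ < m
  to n<2m = ≰⇒> λ m≤⌊n/2⌋ → <⇒≱ n<2m (begin
    2 * m              ≡⟨ 2*m≡m+m ⟩
    m + m              ≤⟨ +-mono-≤ m≤⌊n/2⌋ m≤⌊n/2⌋ ⟩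
    ⌊ n /2⌋ + ⌊ n /2⌋  ≤⟨ ⌊n/2⌋+⌊n/2⌋≤n n ⟩
    n                  ∎)
  from : ⌊ n /2⌋ < m → n < 2 * m
  from ⌊n/2⌋<m = begin-strict
    n                              <⟨ s≤s (n≤1+⌊n/2⌋+⌊n/2⌋ n) ⟩
    suc (suc (⌊ n /2⌋ + ⌊ n /2⌋))  ≡⟨ cong suc (+-suc ⌊ n /2⌋ ⌊ n /2⌋) ⟨
    suc ⌊ n /2⌋ + suc ⌊ n /2⌋      ≤⟨ +-mono-≤ ⌊n/2⌋<m ⌊n/2⌋<m ⟩
    m + m                          ≡⟨ 2*m≡m+m ⟨
    2 * m                          ∎

⌈m+[n+n]/2⌉≡⌈m/2⌉+n : ∀ m n → ⌈ m + (n + n) /2⌉ ≡ ⌈ m /2⌉ + n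
⌈m+[n+n]/2⌉≡⌈m/2⌉+n m zero    = trans (cong ⌈_/2⌉ (+-identityʳ m)) (sym (+-identityʳ ⌈ m /2⌉))
⌈m+[n+n]/2⌉≡⌈m/2⌉+n m (suc n) = begin
  ⌈ m + (suc n + suc n) /2⌉  ≡⟨ cong ⌈_/2⌉ (shift m n) ⟩
  suc ⌈ m + (n + n) /2⌉      ≡⟨ cong suc (⌈m+[n+n]/2⌉≡⌈m/2⌉+n m n) ⟩
  suc (⌈ m /2⌉ + n)          ≡⟨ +-suc ⌈ m /2⌉ n ⟨
  ⌈ m /2⌉ + suc n            ∎
  where
  open ≡-Reasoning
  shift : ∀ m n → m + (suc n + suc n) ≡ 2 + (m + (n + n))
  shift = solve-∀

jacobi-2 : ∀ h → jacobi 2 h ≡ parity ⌈ h /2⌉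
jacobi-2 h = begin
  jacobi 2 h                                ≡⟨ ℙ∑.∑-cong h (λ _ → cong parity ∘ upper≡⌊h/2⌋<) ⟩
  ℙ∑.∑ h (λ x → parity (𝟙 (⌊ h /2⌋ <? x)))  ≡⟨ parity-∑ h (λ x → 𝟙 (⌊ h /2⌋ <? x)) ⟨
  parity (ℕ∑.∑ h (λ x → 𝟙 (⌊ h /2⌋ <? x)))  ≡⟨ cong parity (count-< ⌊ h /2⌋ h) ⟩
  parity (h ∸ ⌊ h /2⌋)                      ≡⟨ cong (λ n → parity (n ∸ ⌊ h /2⌋)) (⌊n/2⌋+⌈n/2⌉≡n h) ⟨
  parity (⌊ h /2⌋ + ⌈ h /2⌉ ∸ ⌊ h /2⌋)      ≡⟨ cong parity (m+n∸m≡n ⌊ h /2⌋ ⌈ h /2⌉) ⟩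
  parity ⌈ h /2⌉                            ∎
  where
  open ≡-Reasoning
  upper≡⌊h/2⌋< : ∀ {x} → x ∈[1‥ h ] → 𝟙 (h <? 2 * x % odd h) ≡ 𝟙 (⌊ h /2⌋ <? x)
  upper≡⌊h/2⌋< {x} (_ , x≤h) =
    trans (cong (λ r → 𝟙 (h <? r)) (m<n⇒m%n≡m 2x<n)) (𝟙-cong (n<2*m⇔⌊n/2⌋<m h x) _ _)
    where
    2x<n : 2 * x < odd h
    2x<n = s≤s (≤-trans (*-monoʳ-≤ 2 x≤h) (≤-reflexive (cong (h +_) (+-identityʳ h))))

jacobi-2-+4* : ∀ h k → jacobi 2 (h + 4 * k) ≡ jacobi 2 h
jacobi-2-+4* h k = begin
  jacobi 2 (h + 4 * k)               ≡⟨ jacobi-2 (h + 4 * k) ⟩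
  parity ⌈ h + 4 * k /2⌉             ≡⟨ cong (parity ∘ ⌈_/2⌉ ∘ (h +_)) (4*k≡2k+2k k) ⟩
  parity ⌈ h + (2 * k + 2 * k) /2⌉   ≡⟨ cong parity (⌈m+[n+n]/2⌉≡⌈m/2⌉+n h (2 * k)) ⟩
  parity (⌈ h /2⌉ + 2 * k)           ≡⟨ ℙₚ.+-homo-+ ⌈ h /2⌉ (2 * k) ⟩
  parity ⌈ h /2⌉ ℙ.+ parity (2 * k)  ≡⟨ cong (parity ⌈ h /2⌉ ℙ.+_) (ℙₚ.*-homo-* 2 k) ⟩
  parity ⌈ h /2⌉ ℙ.+ 0ℙ              ≡⟨ ℙₚ.+-identityʳ (parity ⌈ h /2⌉) ⟩
  parity ⌈ h /2⌉                     ≡⟨ jacobi-2 h ⟨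
  jacobi 2 h                         ∎
  where
  open ≡-Reasoning
  4*k≡2k+2k : ∀ k → 4 * k ≡ 2 * k + 2 * k
  4*k≡2k+2k = solve-∀

odd-shift : ∀ a h t → odd (h + t * (2 * a)) ≡ odd h + t * 4 * a
odd-shift a h t = identity a h t
  where
  identity : ∀ a h t → suc (h + t * (2 * a) + (h + t * (2 * a))) ≡ suc (h + h) + t * 4 * a
  identity = solve-∀

jacobi-odd-periodic : ∀ f h t → Coprime (odd f) (odd h) → jacobi (odd f) (h + t * (2 * odd f)) ≡ jacobi (odd f) h
jacobi-odd-periodic f h t a⊥n = ℙₚ.+-cancelʳ-≡ (jacobi (odd h) f) (jacobi a h′) (jacobi a h) (begin
  jacobi a h′ ℙ.+ jacobi (odd h) f              ≡⟨ cong (jacobi a h′ ℙ.+_) (jacobi-+* {f} (odd h) (t * 4)) ⟨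
  jacobi a h′ ℙ.+ jacobi (odd h + t * 4 * a) f  ≡⟨ cong (λ n → jacobi a h′ ℙ.+ jacobi n f) (odd-shift a h t) ⟨
  jacobi a h′ ℙ.+ jacobi (odd h′) f             ≡⟨ reciprocity {f} {h′} a⊥n′ ⟩
  parity h′ ℙ.* parity f                        ≡⟨ cong (ℙ._* parity f) parity-h′ ⟩
  parity h ℙ.* parity f                         ≡⟨ reciprocity {f} {h} a⊥n ⟨
  jacobi a h ℙ.+ jacobi (odd h) f               ∎)
  where
  open ≡-Reasoning
  a h′ : ℕ
  a = odd f
  h′ = h + t * (2 * a)
  a⊥n′ : Coprime a (odd h′)
  a⊥n′ = subst (Coprime a) (sym (odd-shift a h t)) (coprime-+* (t * 4) a⊥n)
  parity-h′ : parity h′ ≡ parity h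
  parity-h′ = begin
    parity (h + t * (2 * a))           ≡⟨ ℙₚ.+-homo-+ h (t * (2 * a)) ⟩
    parity h ℙ.+ parity (t * (2 * a))  ≡⟨ cong (parity h ℙ.+_) (ℙₚ.*-homo-* t (2 * a)) ⟩
    parity h ℙ.+ (parity t ℙ.* parity (2 * a))
                                       ≡⟨ cong (λ p → parity h ℙ.+ (parity t ℙ.* p)) (ℙₚ.*-homo-* 2 a) ⟩
    parity h ℙ.+ (parity t ℙ.* 0ℙ)     ≡⟨ cong (parity h ℙ.+_) (ℙₚ.*-zeroʳ (parity t)) ⟩
    parity h ℙ.+ 0ℙ                    ≡⟨ ℙₚ.+-identityʳ (parity h) ⟩
    parity h                           ∎

-- (a/n) depends only on n mod 4a; here n = 2h+1 moves by 4ta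
jacobi-periodic : ∀ a h t → Coprime a (odd h) → jacobi a (h + t * (2 * a)) ≡ jacobi a h
jacobi-periodic a = go a (<-wellFounded a)
  where
  go : ∀ a → Acc _<_ a → ∀ h t → Coprime a (odd h) → jacobi a (h + t * (2 * a)) ≡ jacobi a h
  go a (acc rec) h t a⊥n with double⊎odd a
  ... | f     , inj₂ refl = jacobi-odd-periodic f h t a⊥n
  ... | zero  , inj₁ refl = cong (jacobi 0) (trans (cong (h +_) (*-zeroʳ t)) (+-identityʳ h))
  ... | suc c , inj₁ refl = begin
    jacobi a h′                   ≡⟨ cong (λ b → jacobi b h′) a≡2c ⟩
    jacobi (2 * c′) h′            ≡⟨ jacobi-* {h′} (2-coprime-odd h′) (coprime-*ʳ {2} {c′} 2c⊥n′) ⟩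
    jacobi 2 h′ ℙ.+ jacobi c′ h′  ≡⟨ cong₂ ℙ._+_ 2-part c′-part ⟩
    jacobi 2 h ℙ.+ jacobi c′ h    ≡⟨ jacobi-* {h} (2-coprime-odd h) c′⊥n ⟨
    jacobi (2 * c′) h             ≡⟨ cong (λ b → jacobi b h) a≡2c ⟨
    jacobi a h                    ∎
    where
    open ≡-Reasoning
    c′ h′ : ℕ
    c′ = suc c
    h′ = h + t * (2 * a)
    a≡2c : a ≡ 2 * c′
    a≡2c = cong (c′ +_) (sym (+-identityʳ c′))
    c′⊥n : Coprime c′ (odd h)
    c′⊥n = coprime-*ʳ {2} (subst (λ b → Coprime b (odd h)) a≡2c a⊥n)
    2c⊥n′ : Coprime (2 * c′) (odd h′)
    2c⊥n′ = subst₂ Coprime a≡2c (sym (odd-shift a h t)) (coprime-+* (t * 4) a⊥n)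
    h′≡h+4tc : ∀ h t c → h + t * (2 * (c + c)) ≡ h + 4 * (t * c)
    h′≡h+4tc = solve-∀
    h′≡h+2t2c : ∀ h t c → h + t * (2 * (c + c)) ≡ h + t * 2 * (2 * c)
    h′≡h+2t2c = solve-∀
    2-part : jacobi 2 h′ ≡ jacobi 2 h
    2-part = trans (cong (jacobi 2) (h′≡h+4tc h t c′)) (jacobi-2-+4* h (t * c′))
    c′-part : jacobi c′ h′ ≡ jacobi c′ h
    c′-part = trans (cong (jacobi c′) (h′≡h+2t2c h t c′)) (go c′ (rec (m<m+n c′ z<s)) h (t * 2) c′⊥n)

-- Continuants

step : ℕ → ℕ × ℕ → ℕ × ℕ
step a (p , q) = a * p + q , p

-- act w v = M(w₁) ⋯ M(wₖ) v, where M(a) = [[a, 1], [1, 0]]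
act : List ℕ → ℕ × ℕ → ℕ × ℕ
act w v = foldr step v w

cont≡act : ∀ as → cont as ≡ act as (1 , 0)
cont≡act []       = refl
cont≡act (a ∷ as) = cong (step a) (cont≡act as)

_·_ : ℕ × ℕ → ℕ × ℕ → ℕ
(a , b) · (c , d) = a * c + b * d

·-step : ∀ a u v → u · step a v ≡ step a u · v
·-step a (u₁ , u₂) (v₁ , v₂) = identity a u₁ u₂ v₁ v₂
  where
  identity : ∀ a u₁ u₂ v₁ v₂ → u₁ * (a * v₁ + v₂) + u₂ * v₁ ≡ (a * u₁ + u₂) * v₁ + u₁ * v₂
  identity = solve-∀

·-act : ∀ w u v → u · act w v ≡ act (reverse w) u · v
·-act w u v = trans (go w u) (cong (_· v) (sym (reverse-foldr step u w)))
  where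
  go : ∀ w u → u · act w v ≡ foldl (flip step) u w · v
  go []      u = refl
  go (a ∷ w) u = trans (·-step a u (act w v)) (go w (step a u))

coprime-step : ∀ a {p q} → Coprime p q → Coprime (a * p + q) p
coprime-step a p⊥q (d∣ap+q , d∣p) = p⊥q (d∣p , ∣m+n∣m⇒∣n d∣ap+q (∣n⇒∣m*n a d∣p))

cont-coprime : ∀ as → Coprime (proj₁ (cont as)) (proj₂ (cont as))
cont-coprime []       = 1-coprimeTo 0
cont-coprime (a ∷ as) = coprime-step a (cont-coprime as)

cont-pos : ∀ {as} → All (0 <_) as → 0 < proj₁ (cont as)
cont-pos []                    = z<s
cont-pos {a ∷ as} (a>0 ∷ as>0) = ≤-trans (*-mono-≤ a>0 (cont-pos as>0)) (m≤m+n (a * proj₁ (cont as)) _)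

den-cf0 : ∀ as → 0 < proj₁ (cont as) → den (cf0 as) ≡ proj₁ (cont as)
den-cf0 as p>0 with cont as | cont-coprime as | p>0
... | suc p , q | p⊥q | _ = cong den (normalize-coprime (Coprimality.sym p⊥q))

L-cf0 : ∀ as → 0 < proj₁ (cont as) → L (cf0 as) ≡ 3 * proj₂ (cont as) + 5 * proj₁ (cont as)
L-cf0 as p>0 with cont as | cont-coprime as | p>0
... | suc p , q | p⊥q | _ = cong L (normalize-coprime (Coprimality.sym p⊥q))

-- No square values

data EvenResidue : ℕ × ℕ → Set where
  odd-even : ∀ s u → jacobi (4 * u) (s + s) ≡ 0ℙ → EvenResidue (odd (s + s) , 4 * u)
  even-odd : ∀ s u → jacobi (4 * s) (u + u) ≡ 0ℙ → EvenResidue (4 * s , odd (u + u))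

EvenResidue-step : ∀ c {v} → EvenResidue v → Coprime (proj₁ v) (proj₂ v) → EvenResidue (step (c * 4) v)
EvenResidue-step c (odd-even s u QR) _ =
  subst EvenResidue (cong (_, P) (sym (identity c P u))) (even-odd (c * P + u) s (begin
    jacobi (4 * (c * P + u)) (s + s)    ≡⟨ cong (λ a → jacobi a (s + s)) (identity c P u) ⟨
    jacobi (c * 4 * P + 4 * u) (s + s)  ≡⟨ cong (λ a → jacobi a (s + s)) (+-comm (c * 4 * P) (4 * u)) ⟩
    jacobi (4 * u + c * 4 * P) (s + s)  ≡⟨ jacobi-+* {s + s} (4 * u) (c * 4) ⟩
    jacobi (4 * u) (s + s)              ≡⟨ QR ⟩
    0ℙ                                  ∎))
  where
  open ≡-Reasoning
  P : ℕ
  P = odd (s + s)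
  identity : ∀ c P u → c * 4 * P + 4 * u ≡ 4 * (c * P + u)
  identity = solve-∀
EvenResidue-step c (even-odd s u QR) P⊥Q =
  subst EvenResidue (cong (_, 4 * s) (sym (odd-identity c s u))) (odd-even u′ s (begin
    jacobi (4 * s) (u′ + u′)                    ≡⟨ cong (jacobi (4 * s)) (h-identity c s u) ⟩
    jacobi (4 * s) (u + u + c * (2 * (4 * s)))  ≡⟨ jacobi-periodic (4 * s) (u + u) c P⊥Q ⟩
    jacobi (4 * s) (u + u)                      ≡⟨ QR ⟩
    0ℙ                                          ∎))
  where
  open ≡-Reasoning
  u′ : ℕ
  u′ = u + c * (4 * s)
  h-identity : ∀ c s u → u + c * (4 * s) + (u + c * (4 * s)) ≡ u + u + c * (2 * (4 * s))
  h-identity = solve-∀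
  odd-identity : ∀ c s u → c * 4 * (4 * s) + suc (u + u + (u + u))
                           ≡ suc (u + c * (4 * s) + (u + c * (4 * s)) + (u + c * (4 * s) + (u + c * (4 * s))))
  odd-identity = solve-∀

cont-EvenResidue : ∀ {as} → All (4 ∣_) as → EvenResidue (cont as)
cont-EvenResidue []                                = odd-even 0 0 refl
cont-EvenResidue {_ ∷ as} (divides c refl ∷ 4∣as) = EvenResidue-step c (cont-EvenResidue 4∣as) (cont-coprime as)

k*k%4≢3 : ∀ k → k * k % 4 ≢ 3
k*k%4≢3 k with k % 4 | m%n<n k 4 | %-distribˡ-* k k 4
... | 0 | _ | eq = λ k²≡3 → contradiction (trans (sym eq) k²≡3) λ ()
... | 1 | _ | eq = λ k²≡3 → contradiction (trans (sym eq) k²≡3) λ ()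
... | 2 | _ | eq = λ k²≡3 → contradiction (trans (sym eq) k²≡3) λ ()
... | 3 | _ | eq = λ k²≡3 → contradiction (trans (sym eq) k²≡3) λ ()
... | suc (suc (suc (suc _))) | s≤s (s≤s (s≤s (s≤s ()))) | _

-- For P = 4s + 1 and Q = 4u put D = 3Q + 5P and C = 2Q + 3P = 2hC + 1.  Then 2D = P + 3C and
-- 5C = 3D + Q, so (D/C) = (2/C)(P/C) = (2/C)(C/P) = (2/C)(2/P)(Q/P) = -(Q/P).
module _ (s u : ℕ) (P⊥Q : Coprime (odd (s + s)) (4 * u)) (QR : jacobi (4 * u) (s + s) ≡ 0ℙ) where

  private
    P Q D c hC C : ℕ
    P = odd (s + s)
    Q = 4 * u
    D = 3 * Q + 5 * P
    c = 2 * u + 3 * s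
    hC = suc (c + c)
    C = odd hC

    C≡2Q+3P : C ≡ 2 * Q + 3 * P
    C≡2Q+3P = identity s u
      where
      identity : ∀ s u → suc (suc (2 * u + 3 * s + (2 * u + 3 * s)) + suc (2 * u + 3 * s + (2 * u + 3 * s)))
                         ≡ 2 * (4 * u) + 3 * suc (s + s + (s + s))
      identity = solve-∀

    2D≡P+3C : 2 * D ≡ P + 3 * C
    2D≡P+3C = identity s u
      where
      identity : ∀ s u → 2 * (3 * (4 * u) + 5 * suc (s + s + (s + s)))
                         ≡ suc (s + s + (s + s))
                           + 3 * suc (suc (2 * u + 3 * s + (2 * u + 3 * s)) + suc (2 * u + 3 * s + (2 * u + 3 * s)))
      identity = solve-∀

    5C≡3D+Q : 5 * C ≡ 3 * D + Q
    5C≡3D+Q = identity s u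
      where
      identity : ∀ s u → 5 * suc (suc (2 * u + 3 * s + (2 * u + 3 * s)) + suc (2 * u + 3 * s + (2 * u + 3 * s)))
                         ≡ 3 * (3 * (4 * u) + 5 * suc (s + s + (s + s))) + 4 * u
      identity = solve-∀

    D⊥C : Coprime D C
    D⊥C {d} (d∣D , d∣C) = P⊥Q (d∣P , d∣Q)
      where
      d∣P : d ∣ P
      d∣P = ∣m+n∣m⇒∣n (subst (d ∣_) (trans 2D≡P+3C (+-comm P (3 * C))) (∣n⇒∣m*n 2 d∣D)) (∣n⇒∣m*n 3 d∣C)
      d∣Q : d ∣ Q
      d∣Q = ∣m+n∣m⇒∣n (subst (d ∣_) 5C≡3D+Q (∣n⇒∣m*n 5 d∣C)) (∣n⇒∣m*n 3 d∣D)

    P⊥C : Coprime P C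
    P⊥C {d} (d∣P , d∣C) = coprime-* (2-coprime-odd (s + s)) (Coprimality.sym P⊥Q) (d∣2Q , d∣P)
      where
      d∣2Q : d ∣ 2 * Q
      d∣2Q = ∣m+n∣m⇒∣n (subst (d ∣_) (trans C≡2Q+3P (+-comm (2 * Q) (3 * P))) d∣C) (∣n⇒∣m*n 3 d∣P)

    jacobi-2-C : jacobi 2 hC ≡ parity s ℙ.⁻¹
    jacobi-2-C = begin
      jacobi 2 hC      ≡⟨ jacobi-2 hC ⟩
      parity ⌈ hC /2⌉  ≡⟨ cong (parity ∘ suc) (n≡⌊n+n/2⌋ c) ⟨
      parity (1 + c)   ≡⟨ ℙₚ.+-homo-+ 1 c ⟩
      parity c ℙ.⁻¹    ≡⟨ cong ℙ._⁻¹ (trans (ℙₚ.+-homo-+ (2 * u) (3 * s))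
                                            (cong₂ ℙ._+_ (ℙₚ.*-homo-* 2 u) (ℙₚ.*-homo-* 3 s))) ⟩
      parity s ℙ.⁻¹    ∎
      where open ≡-Reasoning

    jacobi-C-P : jacobi C (s + s) ≡ parity s
    jacobi-C-P = begin
      jacobi C (s + s)                       ≡⟨ cong (λ a → jacobi a (s + s)) C≡2Q+3P ⟩
      jacobi (2 * Q + 3 * P) (s + s)         ≡⟨ jacobi-+* {s + s} (2 * Q) 3 ⟩
      jacobi (2 * Q) (s + s)                 ≡⟨ jacobi-* {s + s} (2-coprime-odd (s + s)) (Coprimality.sym P⊥Q) ⟩
      jacobi 2 (s + s) ℙ.+ jacobi Q (s + s)  ≡⟨ cong₂ ℙ._+_ (jacobi-2 (s + s)) QR ⟩
      parity ⌈ s + s /2⌉ ℙ.+ 0ℙ              ≡⟨ ℙₚ.+-identityʳ _ ⟩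
      parity ⌈ s + s /2⌉                     ≡⟨ cong parity (n≡⌈n+n/2⌉ s) ⟨
      parity s                               ∎
      where open ≡-Reasoning

    jacobi-D-C : jacobi D hC ≡ 1ℙ
    jacobi-D-C = p⁻¹+q≡p⇒q≡1ℙ (begin
      parity s ℙ.⁻¹ ℙ.+ jacobi D hC  ≡⟨ cong (ℙ._+ jacobi D hC) jacobi-2-C ⟨
      jacobi 2 hC ℙ.+ jacobi D hC    ≡⟨ jacobi-* {hC} (2-coprime-odd hC) D⊥C ⟨
      jacobi (2 * D) hC              ≡⟨ cong (λ a → jacobi a hC) 2D≡P+3C ⟩
      jacobi (P + 3 * C) hC          ≡⟨ jacobi-+* {hC} P 3 ⟩
      jacobi P hC                    ≡⟨ p+q≡0ℙ⇒p≡q (trans (reciprocity {s + s} {hC} P⊥C) P-even) ⟩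
      jacobi C (s + s)               ≡⟨ jacobi-C-P ⟩
      parity s                       ∎)
      where
      open ≡-Reasoning
      P-even : parity hC ℙ.* parity (s + s) ≡ 0ℙ
      P-even = trans (cong (parity hC ℙ.*_) (parity-double s)) (ℙₚ.*-zeroʳ (parity hC))
      p⁻¹+q≡p⇒q≡1ℙ : ∀ {p q} → p ℙ.⁻¹ ℙ.+ q ≡ p → q ≡ 1ℙ
      p⁻¹+q≡p⇒q≡1ℙ {0ℙ} {1ℙ} _ = refl
      p⁻¹+q≡p⇒q≡1ℙ {1ℙ} {1ℙ} _ = refl

  3Q+5P≢square : ∀ k → 3 * (4 * u) + 5 * odd (s + s) ≢ k * k
  3Q+5P≢square k D≡k*k =
    contradiction (trans (sym jacobi-D-C) (trans (cong (λ a → jacobi a hC) D≡k*k) (jacobi-square k⊥C))) λ ()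
    where
    k⊥C : Coprime k C
    k⊥C = coprime-*ˡ {k} {k} (subst (λ a → Coprime a C) D≡k*k D⊥C)

EvenResidue⇒3q+5p≢square : ∀ {p q} → EvenResidue (p , q) → Coprime p q → ∀ k → 3 * q + 5 * p ≢ k * k
EvenResidue⇒3q+5p≢square (odd-even s u QR) P⊥Q k = 3Q+5P≢square s u P⊥Q QR k
EvenResidue⇒3q+5p≢square (even-odd s u _)  _   k eq = k*k%4≢3 k (trans (cong (_% 4) (sym eq)) 3q+5p%4≡3)
  where
  3q+5p%4≡3 : (3 * odd (u + u) + 5 * (4 * s)) % 4 ≡ 3
  3q+5p%4≡3 = trans (cong (_% 4) (identity s u)) ([m+kn]%n≡m%n 3 (3 * u + 5 * s) 4)
    where
    identity : ∀ s u → 3 * suc (u + u + (u + u)) + 5 * (4 * s) ≡ 3 + (3 * u + 5 * s) * 4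
    identity = solve-∀

-- Admissibility

split : ∀ p → 1 < p → ∀ m → 0 < m → ∃₂ λ e r → m ≡ p ^ e * r × ¬ p ∣ r
split p 1<p m = go m (<-wellFounded m)
  where
  go : ∀ m → Acc _<_ m → 0 < m → ∃₂ λ e r → m ≡ p ^ e * r × ¬ p ∣ r
  go m (acc rec) m>0 with p ∣? m
  ... | no  p∤m = 0 , m , sym (+-identityʳ m) , p∤m
  ... | yes (divides q refl) =
    let e , r , q≡pᵉr , p∤r = go q (rec q<q*p) q>0
    in suc e , r , trans (cong (_* p) q≡pᵉr) (identity (p ^ e) r p) , p∤r
    where
    q>0 : 0 < q
    q>0 = n≢0⇒n>0 λ { refl → <-irrefl refl m>0 }
    q<q*p : q < q * p
    q<q*p = m<m*n q p {{>-nonZero q>0}} 1<p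
    identity : ∀ a r p → a * r * p ≡ p * a * r
    identity = solve-∀

-- the witness k is the largest divisor of m prime to p
prime+*-coprime : ∀ {p c} → Prime p → ¬ p ∣ c → ∀ m → 0 < m → ∃ λ k → Coprime (p + k * c) m
prime+*-coprime {p} {c} p-prime p∤c m m>0 =
  let e , r , m≡pᵉr , p∤r = split p (nonTrivial⇒n>1 p {{prime⇒nonTrivial p-prime}}) m m>0
  in r , subst (Coprime (p + r * c)) (sym m≡pᵉr) (Coprimality.sym (coprime-* (pᵉ⊥ p∤r e) (r⊥ p∤r)))
  where
  module _ {r} (p∤r : ¬ p ∣ r) where
    p⊥ : Coprime p (p + r * c)
    p⊥ {d} (d∣p , d∣p+rc) with prime⇒irreducible p-prime d∣p
    ... | inj₁ d≡1 = d≡1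
    ... | inj₂ refl with euclidsLemma r c p-prime (∣m+n∣m⇒∣n d∣p+rc (∣-refl {p}))
    ...   | inj₁ p∣r = contradiction p∣r p∤r
    ...   | inj₂ p∣c = contradiction p∣c p∤c
    pᵉ⊥ : ∀ e → Coprime (p ^ e) (p + r * c)
    pᵉ⊥ zero    = 1-coprimeTo _
    pᵉ⊥ (suc e) = coprime-* p⊥ (pᵉ⊥ e)
    r⊥ : Coprime r (p + r * c)
    r⊥ {d} (d∣r , d∣p+rc)
      with prime⇒irreducible p-prime (∣m+n∣m⇒∣n (subst (d ∣_) (+-comm p (r * c)) d∣p+rc) (∣m⇒∣m*n c d∣r))
    ... | inj₁ d≡1 = d≡1
    ... | inj₂ refl = contradiction d∣r p∤r

act-replicate-+ : ∀ i j a v → act (replicate (i + j) a) v ≡ act (replicate i a) (act (replicate j a) v)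
act-replicate-+ zero    j a v = refl
act-replicate-+ (suc i) j a v = cong (step a) (act-replicate-+ i j a v)

act-replicate-step : ∀ i a v → act (replicate i a) (step a v) ≡ step a (act (replicate i a) v)
act-replicate-step zero    a v = refl
act-replicate-step (suc i) a v = cong (step a) (act-replicate-step i a v)

act-linear : ∀ w x y → act w (x , y) ≡
  (x * proj₁ (act w (1 , 0)) + y * proj₁ (act w (0 , 1)) , x * proj₂ (act w (1 , 0)) + y * proj₂ (act w (0 , 1)))
act-linear []      x y = cong₂ _,_ (identity₁ x y) (identity₂ x y)
  where
  identity₁ : ∀ x y → x ≡ x * 1 + y * 0
  identity₁ = solve-∀
  identity₂ : ∀ x y → y ≡ x * 0 + y * 1
  identity₂ = solve-∀
act-linear (a ∷ w) x y =
  trans (cong (step a) (act-linear w x y)) (cong (_, x * p₁ + y * p₂) (identity a x y p₁ p₂ q₁ q₂))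
  where
  p₁ q₁ p₂ q₂ : ℕ
  p₁ = proj₁ (act w (1 , 0))
  q₁ = proj₂ (act w (1 , 0))
  p₂ = proj₁ (act w (0 , 1))
  q₂ = proj₂ (act w (0 , 1))
  identity : ∀ a x y p₁ p₂ q₁ q₂ →
             a * (x * p₁ + y * p₂) + (x * q₁ + y * q₂) ≡ x * (a * p₁ + q₁) + y * (a * p₂ + q₂)
  identity = solve-∀

repeat : ℕ → List ℕ → List ℕ
repeat j w = concat (replicate j w)

module Modulo (m : ℕ) .{{_ : NonZero m}} where

  infix 4 _≈_ _≈²_

  _≈_ : ℕ → ℕ → Set
  x ≈ y = x % m ≡ y % m

  mod² : ℕ × ℕ → ℕ × ℕ
  mod² (x , y) = x % m , y % m

  _≈²_ : ℕ × ℕ → ℕ × ℕ → Set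
  u ≈² v = mod² u ≡ mod² v

  ≈-setoid : Setoid _ _
  ≈-setoid = On.setoid (≡-setoid ℕ) (_% m)

  ≈²-setoid : Setoid _ _
  ≈²-setoid = On.setoid (≡-setoid (ℕ × ℕ)) mod²

  ≈-+ : ∀ {a b c d} → a ≈ b → c ≈ d → a + c ≈ b + d
  ≈-+ {a} {b} {c} {d} a≈b c≈d = begin
    (a + c) % m          ≡⟨ %-distribˡ-+ a c m ⟩
    (a % m + c % m) % m  ≡⟨ cong₂ (λ x y → (x + y) % m) a≈b c≈d ⟩
    (b % m + d % m) % m  ≡⟨ %-distribˡ-+ b d m ⟨
    (b + d) % m          ∎
    where open ≡-Reasoning

  ≈-* : ∀ {a b c d} → a ≈ b → c ≈ d → a * c ≈ b * d
  ≈-* {a} {b} {c} {d} a≈b c≈d = begin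
    a * c % m            ≡⟨ %-distribˡ-* a c m ⟩
    a % m * (c % m) % m  ≡⟨ cong₂ (λ x y → x * y % m) a≈b c≈d ⟩
    b % m * (d % m) % m  ≡⟨ %-distribˡ-* b d m ⟨
    b * d % m            ∎
    where open ≡-Reasoning

  ≈²⇒≈ : ∀ {x y x′ y′} → (x , y) ≈² (x′ , y′) → x ≈ x′ × y ≈ y′
  ≈²⇒≈ eq = cong proj₁ eq , cong proj₂ eq

  step-cong : ∀ a {u v} → u ≈² v → step a u ≈² step a v
  step-cong a u≈v = let p≈p′ , q≈q′ = ≈²⇒≈ u≈v in cong₂ _,_ (≈-+ (≈-* {a} refl p≈p′) q≈q′) p≈p′

  step-cancel : ∀ a {u v} → step a u ≈² step a v → u ≈² v
  step-cancel a {p , q} {p′ , q′} eq =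
    let ap+q≈ap′+q′ , p≈p′ = ≈²⇒≈ eq
    in cong₂ _,_ p≈p′ (+-cancelˡ-% (a * p) m (trans ap+q≈ap′+q′ (≈-+ (≈-* {a} refl (sym p≈p′)) refl)))

  act-cong : ∀ w {u v} → u ≈² v → act w u ≈² act w v
  act-cong []      u≈v = u≈v
  act-cong (a ∷ w) u≈v = step-cong a (act-cong w u≈v)

  act-replicate-cancel : ∀ i a {u v} → act (replicate i a) u ≈² act (replicate i a) v → u ≈² v
  act-replicate-cancel zero    a eq = eq
  act-replicate-cancel (suc i) a eq = act-replicate-cancel i a (step-cancel a eq)

  private
    fin : ℕ → Fin m
    fin x = fromℕ< (m%n<n x m)

    code : ℕ × ℕ → Fin (m * m)
    code (x , y) = combine (fin x) (fin y)

    code-injective : ∀ u v → code u ≡ code v → u ≈² v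
    code-injective (x , y) (x′ , y′) eq =
      let x≡x′ , y≡y′ = Finₚ.combine-injective (fin x) (fin y) (fin x′) (fin y′) eq
      in cong₂ _,_ (Finₚ.fromℕ<-injective (x % m) (x′ % m) (m%n<n x m) (m%n<n x′ m) x≡x′)
                   (Finₚ.fromℕ<-injective (y % m) (y′ % m) (m%n<n y m) (m%n<n y′ m) y≡y′)

    orbit : ℕ → ℕ × ℕ
    orbit k = act (replicate k 4) (1 , 0)

  -- M(4) has finite order modulo m: pigeonhole on the orbit of (1, 0), then linearity
  period : ∃ λ d → ∀ v → act (replicate (suc d) 4) v ≈² v
  period with Finₚ.pigeonhole (n<1+n (m * m)) (λ k → code (orbit (toℕ k)))
  ... | i , j , i<j , codes≡ with m≤n⇒∃[o]m+o≡n i<j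
  ... | d , i+1+d≡j = d , fixes
    where
    W : List ℕ
    W = replicate (suc d) 4
    j≡i+[1+d] : toℕ j ≡ toℕ i + suc d
    j≡i+[1+d] = trans (sym i+1+d≡j) (sym (+-suc (toℕ i) d))
    fixes-e₁ : act W (1 , 0) ≈² (1 , 0)
    fixes-e₁ = sym (act-replicate-cancel (toℕ i) 4 (trans (code-injective _ _ codes≡)
                 (cong mod² (trans (cong orbit j≡i+[1+d]) (act-replicate-+ (toℕ i) (suc d) 4 (1 , 0))))))
    fixes-e₂ : act W (0 , 1) ≈² (0 , 1)
    fixes-e₂ = step-cancel 4 (trans (cong mod² (sym (act-replicate-step (suc d) 4 (0 , 1)))) fixes-e₁)
    fixes : ∀ v → act W v ≈² v
    fixes (x , y) = trans (cong mod² (act-linear W x y)) (trans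
      (cong₂ _,_ (≈-+ (≈-* {x} refl p₁≈1) (≈-* {y} refl p₂≈0)) (≈-+ (≈-* {x} refl q₁≈0) (≈-* {y} refl q₂≈1)))
      (cong mod² (cong₂ _,_ (identity₁ x y) (identity₂ x y))))
      where
      p₁≈1 : proj₁ (act W (1 , 0)) ≈ 1
      p₁≈1 = proj₁ (≈²⇒≈ fixes-e₁)
      q₁≈0 : proj₂ (act W (1 , 0)) ≈ 0
      q₁≈0 = proj₂ (≈²⇒≈ fixes-e₁)
      p₂≈0 : proj₁ (act W (0 , 1)) ≈ 0
      p₂≈0 = proj₁ (≈²⇒≈ fixes-e₂)
      q₂≈1 : proj₂ (act W (0 , 1)) ≈ 1
      q₂≈1 = proj₂ (≈²⇒≈ fixes-e₂)
      identity₁ : ∀ x y → x * 1 + y * 0 ≡ x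
      identity₁ = solve-∀
      identity₂ : ∀ x y → x * 0 + y * 1 ≡ y
      identity₂ = solve-∀

  *-surjective : ∀ {a} → Coprime a m → ∀ t → ∃ λ j → a * j ≈ t
  *-surjective {a} a⊥m t =
    let i , fi≡ft = injective⇒surjective f-injective (fin t)
    in toℕ i , Finₚ.fromℕ<-injective _ _ (m%n<n (a * toℕ i) m) (m%n<n t m) fi≡ft
    where
    f : Fin m → Fin m
    f i = fin (a * toℕ i)
    f-injective : Injective _≡_ _≡_ f
    f-injective {i} {i′} fi≡fi′ = Finₚ.toℕ-injective (begin
      toℕ i       ≡⟨ m<n⇒m%n≡m (Finₚ.toℕ<n i) ⟨
      toℕ i % m   ≡⟨ *-cancelˡ-% (toℕ i) (toℕ i′) m a⊥m
                       (Finₚ.fromℕ<-injective _ _ (m%n<n (a * toℕ i) m) (m%n<n (a * toℕ i′) m) fi≡fi′) ⟩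
      toℕ i′ % m  ≡⟨ m<n⇒m%n≡m (Finₚ.toℕ<n i′) ⟩
      toℕ i′      ∎)
      where open ≡-Reasoning

  private
    d : ℕ
    d = proj₁ period
    R : List ℕ
    R = replicate d 4

    R-inverseˡ : ∀ v → step 4 (act R v) ≈² v
    R-inverseˡ = proj₂ period

    R-inverseʳ : ∀ v → act R (step 4 v) ≈² v
    R-inverseʳ v = trans (cong mod² (act-replicate-step d 4 v)) (R-inverseˡ v)

  -- 8 = 4 + 4 and R acts as M(4)⁻¹, so these words act as the two shears below
  shearˡ shearʳ : List ℕ
  shearˡ = 8 ∷ R
  shearʳ = R ++ 8 ∷ []

  act-shearˡ : ∀ x y → act shearˡ (x , y) ≈² (x + 4 * y , y)
  act-shearˡ x y = cong₂ _,_ (begin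
    8 * a + b            ≡⟨ identity a b ⟩
    4 * a + (4 * a + b)  ≈⟨ ≈-+ (≈-* {4} refl a≈y) 4a+b≈x ⟩
    4 * y + x            ≡⟨ +-comm (4 * y) x ⟩
    x + 4 * y            ∎) a≈y
    where
    open import Relation.Binary.Reasoning.Setoid ≈-setoid
    a b : ℕ
    a = proj₁ (act R (x , y))
    b = proj₂ (act R (x , y))
    4a+b≈x : 4 * a + b ≈ x
    4a+b≈x = proj₁ (≈²⇒≈ (R-inverseˡ (x , y)))
    a≈y : a ≈ y
    a≈y = proj₂ (≈²⇒≈ (R-inverseˡ (x , y)))
    identity : ∀ a b → 8 * a + b ≡ 4 * a + (4 * a + b)
    identity = solve-∀

  act-shearʳ : ∀ x y → act shearʳ (x , y) ≈² (x , y + 4 * x)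
  act-shearʳ x y = begin
    act (R ++ 8 ∷ []) (x , y)       ≡⟨ foldr-++ step (x , y) R (8 ∷ []) ⟩
    act R (step 8 (x , y))          ≡⟨ cong (λ z → act R (z , x)) (identity x y) ⟩
    act R (step 4 (x , 4 * x + y))  ≈⟨ R-inverseʳ (x , 4 * x + y) ⟩
    (x , 4 * x + y)                 ≡⟨ cong (x ,_) (+-comm (4 * x) y) ⟩
    (x , y + 4 * x)                 ∎
    where
    open import Relation.Binary.Reasoning.Setoid ≈²-setoid
    identity : ∀ x y → 8 * x + y ≡ 4 * x + (4 * x + y)
    identity = solve-∀

  act-repeat-shearˡ : ∀ j x y → act (repeat j shearˡ) (x , y) ≈² (x + j * (4 * y) , y)
  act-repeat-shearˡ zero    x y = cong mod² (cong (_, y) (sym (+-identityʳ x)))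
  act-repeat-shearˡ (suc j) x y = begin
    act (shearˡ ++ repeat j shearˡ) (x , y)     ≡⟨ foldr-++ step (x , y) shearˡ (repeat j shearˡ) ⟩
    act shearˡ (act (repeat j shearˡ) (x , y))  ≈⟨ act-cong shearˡ (act-repeat-shearˡ j x y) ⟩
    act shearˡ (x + j * (4 * y) , y)            ≈⟨ act-shearˡ (x + j * (4 * y)) y ⟩
    (x + j * (4 * y) + 4 * y , y)               ≡⟨ cong (_, y) (identity x y j) ⟩
    (x + suc j * (4 * y) , y)                   ∎
    where
    open import Relation.Binary.Reasoning.Setoid ≈²-setoid
    identity : ∀ x y j → x + j * (4 * y) + 4 * y ≡ x + (1 + j) * (4 * y)
    identity = solve-∀

  act-repeat-shearʳ : ∀ k x y → act (repeat k shearʳ) (x , y) ≈² (x , y + k * (4 * x))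
  act-repeat-shearʳ zero    x y = cong mod² (cong (x ,_) (sym (+-identityʳ y)))
  act-repeat-shearʳ (suc k) x y = begin
    act (shearʳ ++ repeat k shearʳ) (x , y)     ≡⟨ foldr-++ step (x , y) shearʳ (repeat k shearʳ) ⟩
    act shearʳ (act (repeat k shearʳ) (x , y))  ≈⟨ act-cong shearʳ (act-repeat-shearʳ k x y) ⟩
    act shearʳ (x , y + k * (4 * x))            ≈⟨ act-shearʳ x (y + k * (4 * x)) ⟩
    (x , y + k * (4 * x) + 4 * x)               ≡⟨ cong (x ,_) (identity x y k) ⟩
    (x , y + suc k * (4 * x))                   ∎
    where
    open import Relation.Binary.Reasoning.Setoid ≈²-setoid
    identity : ∀ x y k → y + k * (4 * x) + 4 * x ≡ y + (1 + k) * (4 * x)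
    identity = solve-∀

  reach : ∀ {A : ℕ → Set} → A 4 → A 8 → ∀ x y k t → Coprime (y + k * (4 * x)) m →
          ∃ λ w → All A w × proj₁ (act w (x , y)) ≈ x + 4 * t
  reach A4 A8 x y k t Y⊥m =
    let j , Yj≈t = *-surjective Y⊥m t
    in repeat j shearˡ ++ repeat k shearʳ ,
       Allₚ.++⁺ (Allₚ.concat⁺ (Allₚ.replicate⁺ j (A8 ∷ Allₚ.replicate⁺ d A4)))
                (Allₚ.concat⁺ (Allₚ.replicate⁺ k (Allₚ.++⁺ (Allₚ.replicate⁺ d A4) (A8 ∷ [])))) ,
       first-component j Yj≈t
    where
    open import Relation.Binary.Reasoning.Setoid ≈-setoid
    Y : ℕ
    Y = y + k * (4 * x)
    first-component : ∀ j → Y * j ≈ t → proj₁ (act (repeat j shearˡ ++ repeat k shearʳ) (x , y)) ≈ x + 4 * t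
    first-component j Yj≈t = begin
      proj₁ (act (repeat j shearˡ ++ repeat k shearʳ) (x , y))
        ≡⟨ cong proj₁ (foldr-++ step (x , y) (repeat j shearˡ) (repeat k shearʳ)) ⟩
      proj₁ (act (repeat j shearˡ) (act (repeat k shearʳ) (x , y)))
        ≈⟨ cong proj₁ (trans (act-cong (repeat j shearˡ) (act-repeat-shearʳ k x y)) (act-repeat-shearˡ j x Y)) ⟩
      x + j * (4 * Y)  ≡⟨ cong (λ z → x + z) (identity j Y) ⟩
      x + 4 * (Y * j)  ≈⟨ ≈-+ {x} refl (≈-* {4} refl Yj≈t) ⟩
      x + 4 * t        ∎
      where
      identity : ∀ j Y → j * (4 * Y) ≡ 4 * (Y * j)
      identity = solve-∀

  -- 5 ≡ 1 and 23 ≡ 3 (mod 4); the primes 3 and 5 do not divide 20 = 4 · 5 and 92 = 4 · 23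
  odd-admissible : ∀ {A : ℕ → Set} → A 4 → A 8 → ∀ N → N % 2 ≡ 1 →
                   ∃ λ w → All A w × proj₁ (act w (5 , 3)) ≈ N
  odd-admissible A4 A8 N N-odd with double⊎odd N
  ... | c , inj₁ refl = contradiction (trans (sym N-odd) (trans (cong (_% 2) (c+c≡c*2 c)) (m*n%n≡0 c 2))) λ ()
    where
    c+c≡c*2 : ∀ c → c + c ≡ c * 2
    c+c≡c*2 = solve-∀
  ... | c , inj₂ refl with double⊎odd c
  ...   | t , inj₁ refl =
    let k , Y⊥m = prime+*-coprime (from-yes (prime? 3)) (from-no (3 ∣? 20)) m (>-nonZero⁻¹ m)
        w , Aw , act≈5+4T = reach A4 A8 5 3 k (t + pred m) Y⊥m
    in w , Aw , (begin
      proj₁ (act w (5 , 3))            ≈⟨ act≈5+4T ⟩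
      5 + 4 * (t + pred m)             ≡⟨ identity t (pred m) ⟩
      odd (t + t) + 4 * suc (pred m)   ≡⟨ cong (λ n → odd (t + t) + 4 * n) (suc-pred m) ⟩
      odd (t + t) + 4 * m              ≈⟨ [m+kn]%n≡m%n (odd (t + t)) 4 m ⟩
      odd (t + t)                      ∎)
    where
    open import Relation.Binary.Reasoning.Setoid ≈-setoid
    identity : ∀ t m′ → 5 + 4 * (t + m′) ≡ suc (t + t + (t + t)) + 4 * suc m′
    identity = solve-∀
  ...   | t , inj₂ refl =
    let k , Y⊥m = prime+*-coprime (from-yes (prime? 5)) (from-no (5 ∣? 92)) m (>-nonZero⁻¹ m)
        w , Aw , act≈23+4T = reach A4 A8 23 5 k (t + 5 * pred m) Y⊥m
    in w ++ 4 ∷ [] , Allₚ.++⁺ Aw (A4 ∷ []) , (begin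
      proj₁ (act (w ++ 4 ∷ []) (5 , 3))      ≡⟨ cong proj₁ (foldr-++ step (5 , 3) w (4 ∷ [])) ⟩
      proj₁ (act w (23 , 5))                 ≈⟨ act≈23+4T ⟩
      23 + 4 * (t + 5 * pred m)              ≡⟨ identity t (pred m) ⟩
      odd (odd t) + 20 * suc (pred m)        ≡⟨ cong (λ n → odd (odd t) + 20 * n) (suc-pred m) ⟩
      odd (odd t) + 20 * m                   ≈⟨ [m+kn]%n≡m%n (odd (odd t)) 20 m ⟩
      odd (odd t)                            ∎)
    where
    open import Relation.Binary.Reasoning.Setoid ≈-setoid
    identity : ∀ t m′ → 23 + 4 * (t + 5 * m′) ≡ suc (suc (t + t) + suc (t + t)) + 20 * suc m′
    identity = solve-∀

All-reverse : ∀ {P : ℕ → Set} {xs} → All P xs → All P (reverse xs)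
All-reverse []                      = []
All-reverse {P} {x ∷ xs} (px ∷ pxs) =
  subst (All P) (sym (unfold-reverse x xs)) (Allₚ.++⁺ (All-reverse pxs) (px ∷ []))

den-cf0-112 : ∀ {as} → All (0 <_) as → den (cf0 (as ++ 1 ∷ 1 ∷ 2 ∷ [])) ≡ proj₁ (act as (5 , 3))
den-cf0-112 {as} as>0 = begin
  den (cf0 (as ++ 1 ∷ 1 ∷ 2 ∷ []))           ≡⟨ den-cf0 (as ++ 1 ∷ 1 ∷ 2 ∷ []) (cont-pos as112>0) ⟩
  proj₁ (cont (as ++ 1 ∷ 1 ∷ 2 ∷ []))         ≡⟨ cong proj₁ (cont≡act (as ++ 1 ∷ 1 ∷ 2 ∷ [])) ⟩
  proj₁ (act (as ++ 1 ∷ 1 ∷ 2 ∷ []) (1 , 0))  ≡⟨ cong proj₁ (foldr-++ step (1 , 0) as (1 ∷ 1 ∷ 2 ∷ [])) ⟩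
  proj₁ (act as (5 , 3))                       ∎
  where
  open ≡-Reasoning
  as112>0 : All (0 <_) (as ++ 1 ∷ 1 ∷ 2 ∷ [])
  as112>0 = Allₚ.++⁺ as>0 (z<s ∷ z<s ∷ z<s ∷ [])

-- M(a₁) ⋯ M(aₙ) has transpose M(aₙ) ⋯ M(a₁)
den-cf0-112≡L-cf0-reverse : ∀ {as} → All (0 <_) as → den (cf0 (as ++ 1 ∷ 1 ∷ 2 ∷ [])) ≡ L (cf0 (reverse as))
den-cf0-112≡L-cf0-reverse {as} as>0 = begin
  den (cf0 (as ++ 1 ∷ 1 ∷ 2 ∷ []))    ≡⟨ den-cf0-112 as>0 ⟩
  proj₁ (act as (5 , 3))               ≡⟨ first (act as (5 , 3)) ⟨
  (1 , 0) · act as (5 , 3)             ≡⟨ ·-act as (1 , 0) (5 , 3) ⟩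
  act (reverse as) (1 , 0) · (5 , 3)   ≡⟨ cong (_· (5 , 3)) (cont≡act (reverse as)) ⟨
  cont (reverse as) · (5 , 3)          ≡⟨ 3q+5p (cont (reverse as)) ⟩
  3 * proj₂ (cont (reverse as)) + 5 * proj₁ (cont (reverse as))
                                       ≡⟨ L-cf0 (reverse as) (cont-pos (All-reverse as>0)) ⟨
  L (cf0 (reverse as))                 ∎
  where
  open ≡-Reasoning
  first : ∀ v → (1 , 0) · v ≡ proj₁ v
  first (x , y) = identity x y
    where
    identity : ∀ x y → 1 * x + 0 * y ≡ x
    identity = solve-∀
  3q+5p : ∀ v → v · (5 , 3) ≡ 3 * proj₂ v + 5 * proj₁ v
  3q+5p (p , q) = identity p q
    where
    identity : ∀ p q → p * 5 + q * 3 ≡ 3 * q + 5 * p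
    identity = solve-∀

module _ {P Q : ℚ → Set} {f g : ℚ → ℕ} (P→Q : ∀ r → P r → ∃[ r′ ] (Q r′ × g r′ ≡ f r)) where

  AllOddAdmissible-transfer : AllOddAdmissible P f → AllOddAdmissible Q g
  AllOddAdmissible-transfer P-admissible m N N-odd =
    let r , Pr , fr≈N = P-admissible m N N-odd
        r′ , Qr′ , gr′≡fr = P→Q r Pr
    in r′ , Qr′ , trans (cong (_% m) gr′≡fr) fr≈N

  NoSquare-transfer : NoSquare Q g → NoSquare P f
  NoSquare-transfer Q-noSquare r Pr (k , fr≡k²) =
    let r′ , Qr′ , gr′≡fr = P→Q r Pr
    in Q-noSquare r′ Qr′ (k , trans gr′≡fr fr≡k²)

module _ {𝒜 : ℕ → Set} (𝒜>0 : ∀ a → 𝒜 a → 0 < a) where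

  private
    positive : ∀ {as} → All 𝒜 as → All (0 <_) as
    positive = All.map (λ {a} → 𝒜>0 a)

  InS⇒InS′-reverse : ∀ r → InS 𝒜 r → ∃[ r′ ] (InS' 𝒜 r′ × L r′ ≡ den r)
  InS⇒InS′-reverse r (as , 𝒜as , refl) =
    cf0 (reverse as) , (reverse as , All-reverse 𝒜as , refl) , sym (den-cf0-112≡L-cf0-reverse (positive 𝒜as))

  InS-allOddAdmissible : 𝒜 4 → 𝒜 8 → AllOddAdmissible (InS 𝒜) den
  InS-allOddAdmissible 𝒜4 𝒜8 m N N-odd =
    let w , 𝒜w , act≈N = Modulo.odd-admissible m 𝒜4 𝒜8 N N-odd
    in cf0 (w ++ 1 ∷ 1 ∷ 2 ∷ []) , (w , 𝒜w , refl) , trans (cong (_% m) (den-cf0-112 (positive 𝒜w))) act≈N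

  InS′-noSquare : (∀ a → 𝒜 a → 4 ∣ a) → NoSquare (InS' 𝒜) L
  InS′-noSquare 4∣𝒜 r (as , 𝒜as , refl) (k , Lr≡k²) =
    EvenResidue⇒3q+5p≢square (cont-EvenResidue (All.map (λ {a} → 4∣𝒜 a) 𝒜as)) (cont-coprime as) k
      (trans (sym (L-cf0 as (cont-pos (positive 𝒜as)))) Lr≡k²)

corollary2p18 : (𝒜 : ℕ → Set) → Admissible𝒜 𝒜 →
    (AllOddAdmissible (InS 𝒜) den × NoSquare (InS 𝒜) den)
    × (AllOddAdmissible (InS' 𝒜) L × NoSquare (InS' 𝒜) L)
corollary2p18 𝒜 𝒜-admissible =
    (InS-allOddAdmissible pos has4 has8 , NoSquare-transfer (InS⇒InS′-reverse pos) (InS′-noSquare pos div4))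
  , (AllOddAdmissible-transfer (InS⇒InS′-reverse pos) (InS-allOddAdmissible pos has4 has8) , InS′-noSquare pos div4)
  where open Admissible𝒜 𝒜-admissible
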